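{- Let $C$ be a square-free integer with $C\equiv 5\pmod 8$ such that for every prime $p\mid C$, $-4$ is a fourth power in $\mathbb{F}_p$. Then the curve $\mathcal{H}_2^C: Cs^2=1+4t^4$ is everywhere locally soluble, i.e. its smooth projective model has a $\mathbf{Q}_v$-point for every place $v$ of $\mathbf{Q}$. -}

module Defs where

open import Data.Nat as ℕ using (ℕ; suc)
open import Data.Nat.Primality using (Prime)
open import Data.Integer as ℤ using (ℤ; +_; -[1+_])
open import Data.Integer.Divisibility using (_∣_)
open import Data.Rational as ℚ using (ℚ)
open import Data.Product using (_×_; ∃; ∃-syntax)
open import Data.Sum using (_⊎_)
open import Data.Empty using (⊥)
open import Relation.Binary.PropositionalEquality using (_≡_)

_≡_[mod_] : ℤ → ℤ → ℤ → Set
a ≡ b [mod m ] = m ∣ (a ℤ.- b)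

SquareFree : ℤ → Set
SquareFree C = ∀ (d : ℕ) → (+ d) ℤ.* (+ d) ∣ C → d ≡ 1

IsFourthPowerMod : ℤ → ℕ → Set
IsFourthPowerMod a p = ∃[ x ] ((x ℤ.^ 4) ≡ a [mod (+ p) ])

-- The curve H_2^C : C s² = 1 + 4 t⁴, smooth projective model in the
-- weighted projective plane P(1,2,1) with coordinates (z : s : t):
--      C s² = z⁴ + 4 t⁴ ,   (z, t) ≠ (0, 0)
-- (the affine chart z = 1 is C s² = 1 + 4 t⁴).

curveEq : ℤ → ℤ → ℤ → ℤ → ℤ
curveEq C z s t = C ℤ.* (s ℤ.^ 2) ℤ.- ((z ℤ.^ 4) ℤ.+ (+ 4) ℤ.* (t ℤ.^ 4))

-- p-adic integers as the inverse limit lim Z/p^k : a sequence of integer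
-- representatives x k of classes mod p^k with x (k+1) ≡ x k (mod p^k).
IsZp : ℕ → (ℕ → ℤ) → Set
IsZp p x = ∀ k → x (suc k) ≡ x k [mod (+ (p ℕ.^ k)) ]

-- After scaling by a power
-- of p (weights (1,2,1)) any Q_p-point has z, t ∈ Z_p with min(v(z),v(t)) = 0;
-- then v(C s²) ≥ 0 and, C being square-free, s ∈ Z_p.  Conversely such a
-- triple is a Q_p-point.  The equation holds in Z_p = lim Z/p^k,
-- i.e. modulo p^k at every level k.
HasQpPoint : ℤ → ℕ → Set
HasQpPoint C p =
  ∃[ z ] ∃[ s ] ∃[ t ]
    ( IsZp p z × IsZp p s × IsZp p t
    × (∀ k → curveEq C (z k) (s k) (t k) ≡ + 0 [mod (+ (p ℕ.^ k)) ])
    × ((+ p ∣ z 1 → + p ∣ t 1 → ⊥) ))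

-- Real numbers à la Bishop: regular sequences of rationals,
-- ∣ x m - x n ∣ ≤ 1/(m+1) + 1/(n+1).

inv : ℕ → ℚ
inv n = (+ 1) ℚ./ suc n

IsReal : (ℕ → ℚ) → Set
IsReal x = ∀ m n → ℚ.∣ x m ℚ.- x n ∣ ℚ.≤ inv m ℚ.+ inv n

TendsToZero : (ℕ → ℚ) → Set
TendsToZero f = ∀ k → ∃[ N ] (∀ n → N ℕ.≤ n → ℚ.∣ f n ∣ ℚ.≤ inv k)

ApartZero : (ℕ → ℚ) → Set
ApartZero x = ∃[ n ] (inv n ℚ.< ℚ.∣ x n ∣)

fromℤ : ℤ → ℚ
fromℤ a = a ℚ./ 1

curveEqℚ : ℤ → ℚ → ℚ → ℚ → ℚ
curveEqℚ C z s t =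
  fromℤ C ℚ.* (s ℚ.* s) ℚ.- ((z ℚ.* z ℚ.* z ℚ.* z) ℚ.+ fromℤ (+ 4) ℚ.* (t ℚ.* t ℚ.* t ℚ.* t))

-- An ℝ-point of the weighted projective model: reals z, s, t with
-- C s² = z⁴ + 4 t⁴ (the sequence of values converges to 0, i.e. the real
-- number C s² - z⁴ - 4t⁴ equals 0) and (z, t) ≠ (0, 0).
HasRealPoint : ℤ → Set
HasRealPoint C =
  ∃[ z ] ∃[ s ] ∃[ t ]
    ( IsReal z × IsReal s × IsReal t
    × TendsToZero (λ n → curveEqℚ C (z n) (s n) (t n))
    × (ApartZero z ⊎ ApartZero t) )

EverywhereLocallySoluble : ℤ → Set
EverywhereLocallySoluble C = HasRealPoint C × (∀ p → Prime p → HasQpPoint C p)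

-- The real point is (1 : 1/√C : 0), which needs C > 0: a negative C ≡ 5 (mod 8) has
-- |C| ≡ 3 (mod 4), hence a prime factor p ≡ 3 (mod 4), and modulo such a prime -4 is not
-- even a square, let alone a fourth power.  At p = 2 the point (1 : s : 1) only needs
-- C s² = 5, which s = 1 solves modulo 8; Hensel's lemma lifts it because the derivative
-- 2Cs has valuation one.  At an odd prime p it suffices to solve the equation modulo p
-- with p ∤ z, as z then lifts by Hensel's lemma (the derivative is -4z³).  If p ∣ C, or if
-- p ≡ 1 (mod 4) so that -4 = (1 + i)⁴ with i² = -1, take z⁴ ≡ -4 and t = 1.  If p ≡ 3
-- (mod 4) and p ∤ C, every square is a fourth power, so either C ≡ z⁴ (take s = 1, t = 0),
-- or C is a nonresidue; then so is some w⁴ + 4, hence C(w⁴ + 4) ≡ u², and (Cw : Cu : C)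
-- is a point.

module Submission where

open import Defs
open import Data.Nat using (ℕ)
open import Data.Nat.Primality using (Prime)
open import Data.Integer using (ℤ; +_; -_)
open import Data.Integer.Divisibility using (_∣_)

open import Data.Nat.Base as ℕ using (zero; suc; z≤n; s≤s; _≤_; _<_; _%_; _/_)
import Data.Nat.Properties as ℕₚ
open import Data.Nat.Properties using (_≤?_)
import Data.Nat.Divisibility as ℕ
open import Data.Nat.DivMod using (m≡m%n+[m/n]*n; m%n<n; %-distribˡ-*; [m+kn]%n≡m%n)
open import Data.Nat.Combinatorics using (nCn≡1; nC1≡n; nCk+nC[k+1]≡[n+1]C[k+1]) renaming (_C_ to _choose_)
open import Data.Nat.ListAction using (product)
open import Data.Nat.Primality using (euclidsLemma; prime⇒irreducible)
open import Data.Nat.Primality.Factorisation using (factorise; PrimeFactorisation)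
import Data.Nat.Tactic.RingSolver as ℕ-Solver
open import Data.Integer.Base as ℤ using (-[1+_]; _+_; _*_; _-_; _^_; +≤+; +<+)
import Data.Integer.Properties as ℤₚ
open import Data.Integer.DivMod using (_%ℕ_; _/ℕ_; a≡a%ℕn+[a/ℕn]*n)
open import Data.Integer.Divisibility.Signed
  using (divides; _∣?_; ∣-refl; ∣-trans; ∣ᵤ⇒∣; ∣⇒∣ᵤ; ∣m∣n⇒∣m+n; ∣m∣n⇒∣m-n; ∣m⇒∣m*n; ∣n⇒∣m*n; ∣m⇒∣-m; *-monoʳ-∣)
  renaming (_∣_ to _∣ₛ_)
open import Data.Integer.Tactic.RingSolver using (solve-∀)
open import Data.Rational.Base as ℚ using (ℚ; 1ℚ; 0ℚ; toℚᵘ; fromℚᵘ)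
import Data.Rational.Properties as ℚₚ
open import Data.Rational.Unnormalised.Base as ℚᵘ using (ℚᵘ; mkℚᵘ; *≤*; ↥_; ↧_)
  renaming (_≃_ to _≃ᵘ_; _≤_ to _≤ᵘ_)
import Data.Rational.Unnormalised.Properties as ℚᵘₚ
open import Data.Fin.Base using (Fin; zero; suc; toℕ; fromℕ; inject₁)
open import Data.Fin.Properties using (toℕ-fromℕ; toℕ-inject₁; toℕ<n; suc-injective; toℕ-injective)
open import Data.Vec.Base using (Vec; []; _∷_; replicate)
open import Data.List.Base using ([]; _∷_)
open import Data.List.Relation.Unary.All using (All; []; _∷_)
open import Data.Sum using (_⊎_; inj₁; inj₂; [_,_]′)
open import Data.Product using (Σ; ∃; _,_; _×_; proj₁; proj₂)
open import Data.Empty using (⊥; ⊥-elim)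
open import Function using (id)
open import Relation.Nullary using (¬_; yes; no)
open import Relation.Binary.Definitions using (tri<; tri≈; tri>)
open import Relation.Binary.PropositionalEquality

open import Algebra.Properties.CommutativeSemiring.Binomial ℤₚ.+-*-commutativeSemiring using (theorem; binomialTerm)
open import Algebra.Properties.CommutativeSemiring.Exp ℤₚ.+-*-commutativeSemiring using (^-distrib-*)
open import Algebra.Properties.Monoid.Sum ℤₚ.+-0-monoid using (sum; sum-init-last)
open import Algebra.Definitions.RawMonoid ℤ.+-0-rawMonoid using () renaming (_×_ to _·_)
open import Algebra.Definitions.RawSemiring ℤ.+-*-rawSemiring using () renaming (_^_ to _^′_)

-- Fermat's little theorem

euclidsLemmaℤ : ∀ {p} → Prime p → ∀ a b → + p ∣ₛ a * b → + p ∣ₛ a ⊎ + p ∣ₛ b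
euclidsLemmaℤ {p} p-prime a b p∣ab
  with euclidsLemma ℤ.∣ a ∣ ℤ.∣ b ∣ p-prime (subst (p ℕ.∣_) (ℤₚ.abs-* a b) (∣⇒∣ᵤ p∣ab))
... | inj₁ p∣a = inj₁ (∣ᵤ⇒∣ p∣a)
... | inj₂ p∣b = inj₂ (∣ᵤ⇒∣ p∣b)

[k+1]*[n+1]C[k+1]≡[n+1]*nCk : ∀ n k → suc k ℕ.* (suc n choose suc k) ≡ suc n ℕ.* (n choose k)
[k+1]*[n+1]C[k+1]≡[n+1]*nCk zero zero = refl
[k+1]*[n+1]C[k+1]≡[n+1]*nCk zero (suc k) = ℕₚ.*-zeroʳ (suc (suc k))
[k+1]*[n+1]C[k+1]≡[n+1]*nCk (suc n) zero = trans (ℕₚ.+-identityʳ _) (trans (nC1≡n (suc (suc n))) (sym (ℕₚ.*-identityʳ _)))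
[k+1]*[n+1]C[k+1]≡[n+1]*nCk (suc n) (suc k) = begin
  suc (suc k) ℕ.* (suc (suc n) choose suc (suc k))
    ≡⟨ cong (suc (suc k) ℕ.*_) (sym (nCk+nC[k+1]≡[n+1]C[k+1] (suc n) (suc k))) ⟩
  suc (suc k) ℕ.* (A ℕ.+ B)
    ≡⟨ ℕₚ.*-distribˡ-+ (suc (suc k)) A B ⟩
  (A ℕ.+ suc k ℕ.* A) ℕ.+ suc (suc k) ℕ.* B
    ≡⟨ cong₂ (λ u v → (A ℕ.+ u) ℕ.+ v) ([k+1]*[n+1]C[k+1]≡[n+1]*nCk n k) ([k+1]*[n+1]C[k+1]≡[n+1]*nCk n (suc k)) ⟩
  (A ℕ.+ suc n ℕ.* (n choose k)) ℕ.+ suc n ℕ.* (n choose suc k)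
    ≡⟨ ℕₚ.+-assoc A _ _ ⟩
  A ℕ.+ (suc n ℕ.* (n choose k) ℕ.+ suc n ℕ.* (n choose suc k))
    ≡⟨ cong (A ℕ.+_) (sym (ℕₚ.*-distribˡ-+ (suc n) (n choose k) (n choose suc k))) ⟩
  A ℕ.+ suc n ℕ.* (n choose k ℕ.+ n choose suc k)
    ≡⟨ cong (λ u → A ℕ.+ suc n ℕ.* u) (nCk+nC[k+1]≡[n+1]C[k+1] n k) ⟩
  suc (suc n) ℕ.* A ∎
  where
  open ≡-Reasoning
  A : ℕ
  A = suc n choose suc k
  B : ℕ
  B = suc n choose suc (suc k)

prime∣pCk : ∀ {p k} → Prime p → 0 ℕ.< k → k ℕ.< p → p ℕ.∣ p choose k
prime∣pCk {suc n} {suc j} p-prime _ k<p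
  with euclidsLemma (suc j) (suc n choose suc j) p-prime
         (ℕ.divides (n choose j) (trans ([k+1]*[n+1]C[k+1]≡[n+1]*nCk n j) (ℕₚ.*-comm (suc n) (n choose j))))
... | inj₁ p∣k = ⊥-elim (ℕₚ.<⇒≱ k<p (ℕ.∣⇒≤ p∣k))
... | inj₂ p∣pCk = p∣pCk

·≡* : ∀ n z → n · z ≡ + n * z
·≡* zero z = refl
·≡* (suc n) z = begin
  z + n · z         ≡⟨ cong (λ w → z + w) (·≡* n z) ⟩
  z + + n * z       ≡⟨ sym (ℤₚ.suc-* (+ n) z) ⟩
  + suc n * z       ∎
  where open ≡-Reasoning

^′≡^ : ∀ x n → x ^′ n ≡ x ^ n
^′≡^ x zero = refl
^′≡^ x (suc n) = cong (x *_) (^′≡^ x n)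

∣-sum : ∀ {d n} (t : Fin n → ℤ) → (∀ i → d ∣ₛ t i) → d ∣ₛ sum t
∣-sum {n = zero} t _ = divides (+ 0) refl
∣-sum {n = suc n} t d∣t = ∣m∣n⇒∣m+n (d∣t zero) (∣-sum (λ i → t (suc i)) (λ i → d∣t (suc i)))

freshmansDream : ∀ {p} → Prime p → ∀ x y → + p ∣ₛ (x + y) ^ p - x ^ p - y ^ p
freshmansDream {suc n} p-prime x y =
  subst (+ p ∣ₛ_) (sym expansion) (∣-sum middle p∣middle)
  where
  p : ℕ
  p = suc n
  term : Fin (suc p) → ℤ
  term = binomialTerm x y p
  middle : Fin n → ℤ
  middle j = term (suc (inject₁ j))
  p∣middle : ∀ j → + p ∣ₛ middle j
  p∣middle j = subst (+ p ∣ₛ_) (sym (·≡* (p choose suc k) (x ^′ suc k * y ^′ (n ℕ.∸ k))))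
    (∣m⇒∣m*n {m = + (p choose suc k)} (x ^′ suc k * y ^′ (n ℕ.∸ k))
      (∣ᵤ⇒∣ (prime∣pCk p-prime (s≤s z≤n) (s≤s k<n))))
    where
    k : ℕ
    k = toℕ (inject₁ j)
    k<n : k ℕ.< n
    k<n = subst (ℕ._< n) (sym (toℕ-inject₁ j)) (toℕ<n j)
  first : term zero ≡ y ^ p
  first = trans (ℤₚ.+-identityʳ _) (trans (ℤₚ.*-identityˡ _) (^′≡^ y p))
  final : term (suc (fromℕ n)) ≡ x ^ p
  final rewrite toℕ-fromℕ n | nCn≡1 p | ℕₚ.n∸n≡0 n =
    trans (ℤₚ.+-identityʳ _) (trans (ℤₚ.*-identityʳ _) (^′≡^ x p))
  expansion : (x + y) ^ p - x ^ p - y ^ p ≡ sum middle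
  expansion = begin
    (x + y) ^ p - x ^ p - y ^ p
      ≡⟨ cong (λ e → e - x ^ p - y ^ p) (sym (^′≡^ (x + y) p)) ⟩
    (x + y) ^′ p - x ^ p - y ^ p
      ≡⟨ cong (λ e → e - x ^ p - y ^ p) (theorem p x y) ⟩
    (term zero + sum (λ i → term (suc i))) - x ^ p - y ^ p
      ≡⟨ cong (λ e → (term zero + e) - x ^ p - y ^ p) (sum-init-last (λ i → term (suc i))) ⟩
    (term zero + (sum middle + term (suc (fromℕ n)))) - x ^ p - y ^ p
      ≡⟨ cong₂ (λ a b → (a + (sum middle + b)) - x ^ p - y ^ p) first final ⟩
    (y ^ p + (sum middle + x ^ p)) - x ^ p - y ^ p
      ≡⟨ cancel (y ^ p) (sum middle) (x ^ p) ⟩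
    sum middle ∎
    where
    open ≡-Reasoning
    cancel : ∀ a m b → (a + (m + b)) - b - a ≡ m
    cancel = solve-∀

∣m-n⇒∣m^k-n^k : ∀ {d a b} k → d ∣ₛ a - b → d ∣ₛ a ^ k - b ^ k
∣m-n⇒∣m^k-n^k {d} zero _ = divides (+ 0) refl
∣m-n⇒∣m^k-n^k {d} {a} {b} (suc k) d∣a-b =
  subst (d ∣ₛ_) (split a b (a ^ k) (b ^ k))
    (∣m∣n⇒∣m+n (∣n⇒∣m*n a (∣m-n⇒∣m^k-n^k k d∣a-b)) (∣n⇒∣m*n (b ^ k) d∣a-b))
  where
  split : ∀ a b u v → a * (u - v) + v * (a - b) ≡ a * u - b * v
  split = solve-∀

fermat : ∀ {p} → Prime p → ∀ a → + p ∣ₛ a ^ p - a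
fermat {suc n} p-prime a = subst (+ p ∣ₛ_) (split a r (a ^ p) (r ^ p))
  (∣m∣n⇒∣m+n (∣m∣n⇒∣m-n (∣m-n⇒∣m^k-n^k {a = a} {b = r} p p∣a-r) p∣a-r) (fermatℕ (a %ℕ p)))
  where
  p : ℕ
  p = suc n
  r : ℤ
  r = + (a %ℕ p)
  p∣a-r : + p ∣ₛ a - r
  p∣a-r = divides (a /ℕ p) (subst (λ e → e - r ≡ a /ℕ p * + p) (sym (a≡a%ℕn+[a/ℕn]*n a p)) (cancel r _))
    where
    cancel : ∀ r q → r + q - r ≡ q
    cancel = solve-∀
  fermatℕ : ∀ m → + p ∣ₛ (+ m) ^ p - + m
  fermatℕ zero = divides (+ 0) refl
  fermatℕ (suc m) = subst (+ p ∣ₛ_) (step (+ 1) (+ m) ((+ 1 + + m) ^ p) ((+ 1) ^ p) ((+ m) ^ p))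
    (∣m∣n⇒∣m+n (∣m∣n⇒∣m+n (freshmansDream p-prime (+ 1) (+ m)) (fermatℕ m)) p∣1ᵖ-1)
    where
    p∣1ᵖ-1 : + p ∣ₛ (+ 1) ^ p - + 1
    p∣1ᵖ-1 = subst (λ e → + p ∣ₛ e - + 1) (sym (ℤₚ.^-zeroˡ p)) (divides (+ 0) refl)
    step : ∀ a b sᵖ aᵖ bᵖ → ((sᵖ - aᵖ - bᵖ) + (bᵖ - b)) + (aᵖ - a) ≡ sᵖ - (a + b)
    step = solve-∀
  split : ∀ a r aᵖ rᵖ → ((aᵖ - rᵖ) - (a - r)) + (rᵖ - r) ≡ aᵖ - a
  split = solve-∀

^-distribʳ-* : ∀ a b n → (a * b) ^ n ≡ a ^ n * b ^ n
^-distribʳ-* a b n = trans (sym (^′≡^ (a * b) n)) (trans (^-distrib-* a b n) (cong₂ _*_ (^′≡^ a n) (^′≡^ b n)))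

∣⇒∣⁴ : ∀ {d x} → d ∣ₛ x → d ∣ₛ x * x * x * x
∣⇒∣⁴ {x = x} d∣x = ∣m⇒∣m*n x (∣m⇒∣m*n x (∣m⇒∣m*n x d∣x))

∤-small : ∀ {p a} → 0 ℕ.< a → a ℕ.< p → ¬ + p ∣ₛ + a
∤-small {a = suc _} _ a<p p∣a = ℕₚ.<⇒≱ a<p (ℕ.∣⇒≤ (∣⇒∣ᵤ p∣a))

prime∤-* : ∀ {p a b} → Prime p → ¬ + p ∣ₛ a → ¬ + p ∣ₛ b → ¬ + p ∣ₛ a * b
prime∤-* {a = a} {b} p-prime p∤a p∤b p∣ab with euclidsLemmaℤ p-prime a b p∣ab
... | inj₁ p∣a = p∤a p∣a
... | inj₂ p∣b = p∤b p∣b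

prime∣-*⇒∣ʳ : ∀ {p a b} → Prime p → ¬ + p ∣ₛ a → + p ∣ₛ a * b → + p ∣ₛ b
prime∣-*⇒∣ʳ {a = a} {b} p-prime p∤a p∣ab with euclidsLemmaℤ p-prime a b p∣ab
... | inj₁ p∣a = ⊥-elim (p∤a p∣a)
... | inj₂ p∣b = p∣b

prime∣-*⇒∣ˡ : ∀ {p a b} → Prime p → ¬ + p ∣ₛ b → + p ∣ₛ a * b → + p ∣ₛ a
prime∣-*⇒∣ˡ {a = a} {b} p-prime p∤b p∣ab with euclidsLemmaℤ p-prime a b p∣ab
... | inj₁ p∣a = p∣a
... | inj₂ p∣b = ⊥-elim (p∤b p∣b)

modularInverse : ∀ {p a} → Prime p → ¬ + p ∣ₛ a → ∃ λ w → + p ∣ₛ a * w - + 1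
modularInverse {suc (suc r)} {a} p-prime p∤a =
  a ^ r , prime∣-*⇒∣ʳ p-prime p∤a (subst (_ ∣ₛ_) (factor a (a ^ r)) (fermat p-prime a))
  where
  factor : ∀ a w → a * (a * w) - a ≡ a * (a * w - + 1)
  factor = solve-∀

-- Points over ℚₚ from coherent sequences of roots

pᵏ∣pⁿ⁺ᵏ : ∀ p n k → + (p ℕ.^ k) ∣ₛ + (p ℕ.^ (n ℕ.+ k))
pᵏ∣pⁿ⁺ᵏ p n k = divides (+ (p ℕ.^ n)) (trans (cong +_ (ℕₚ.^-distribˡ-+-* p n k)) (ℤₚ.pos-* (p ℕ.^ n) (p ℕ.^ k)))

p∣pᵏ⁺¹ : ∀ p k → + p ∣ₛ + (p ℕ.^ suc k)
p∣pᵏ⁺¹ p k = divides (+ (p ℕ.^ k)) (trans (ℤₚ.pos-* p (p ℕ.^ k)) (ℤₚ.*-comm (+ p) _))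

coherentSequence : ∀ {p} (P : ℕ → ℤ → Set) {x₀} → P 0 x₀ →
  (∀ k {x} → P k x → ∃ λ y → P (suc k) y × + (p ℕ.^ k) ∣ₛ y - x) →
  ∃ λ (x : ℕ → ℤ) → IsZp p x × (∀ k → P k (x k))
coherentSequence {p} P {x₀} P₀ lift = (λ k → proj₁ (approx k)) , coherent , (λ k → proj₂ (approx k))
  where
  approx : ∀ k → Σ ℤ (P k)
  approx zero = x₀ , P₀
  approx (suc k) = let (y , Py , _) = lift k (proj₂ (approx k)) in y , Py
  coherent : IsZp p (λ k → proj₁ (approx k))
  coherent k = ∣⇒∣ᵤ (proj₂ (proj₂ (lift k (proj₂ (approx k)))))

constantZp : ∀ p c → IsZp p (λ _ → c)
constantZp p c k = ∣⇒∣ᵤ (subst (+ (p ℕ.^ k) ∣ₛ_) (sym (ℤₚ.+-inverseʳ c)) (divides (+ 0) refl))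

x^4≡x*x*x*x : ∀ x → x ^ 4 ≡ x * x * x * x
x^4≡x*x*x*x x = trans (cong (λ e → x * (x * (x * e))) (ℤₚ.*-identityʳ x)) (assoc x)
  where
  assoc : ∀ x → x * (x * (x * x)) ≡ x * x * x * x
  assoc = solve-∀

curveEq-expand : ∀ C z s t → curveEq C z s t ≡ C * (s * s) - (z * z * z * z + + 4 * (t * t * t * t))
curveEq-expand C z s t =
  cong₂ (λ a b → C * a - b) (cong (s *_) (ℤₚ.*-identityʳ s)) (cong₂ _+_ (x^4≡x*x*x*x z) (cong (+ 4 *_) (x^4≡x*x*x*x t)))

-- Odd primes: Euler's criterion and Hensel's lemma

-- Newton's step y = x + (D − x⁴)·W for a root of D − x⁴, where W is an inverse of 4x³ modulo p
-- and D − x⁴ = qP.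
quartic-newton : ∀ D x q P W →
  D - (x + P * (q * W)) * (x + P * (q * W)) * (x + P * (q * W)) * (x + P * (q * W))
  ≡ (D - x * x * x * x - q * P)
    + P * (q * (+ 1 - + 4 * (x * x * x) * W)
           - P * ((q * W) * (q * W) * (+ 6 * (x * x) + + 4 * x * (P * (q * W)) + P * (q * W) * (P * (q * W)))))
quartic-newton = solve-∀

oddPrime∤2 : ∀ {m} → Prime (suc (m ℕ.+ m)) → ¬ + suc (m ℕ.+ m) ∣ₛ + 2
oddPrime∤2 {suc m} _ = ∤-small (s≤s z≤n) (s≤s (s≤s (ℕₚ.≤-trans (s≤s z≤n) (ℕₚ.m≤n+m (suc m) m))))

module OddPrime {m} (p-prime : Prime (suc (m ℕ.+ m))) where

  private
    p : ℕ
    p = suc (m ℕ.+ m)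

  p∤2 : ¬ + p ∣ₛ + 2
  p∤2 = oddPrime∤2 {m} p-prime

  p∤4 : ¬ + p ∣ₛ + 4
  p∤4 = prime∤-* p-prime p∤2 p∤2

  fermat-half : ∀ a → + p ∣ₛ a * (a ^ m * a ^ m - + 1)
  fermat-half a = subst (+ p ∣ₛ_) (factor a (a ^ m * a ^ m))
    (subst (λ e → + p ∣ₛ a * e - a) (ℤₚ.^-distribˡ-+-* a m m) (fermat p-prime a))
    where
    factor : ∀ a e → a * e - a ≡ a * (e - + 1)
    factor = solve-∀

  euler-unit : ∀ {a} → ¬ + p ∣ₛ a → + p ∣ₛ a ^ m * a ^ m - + 1
  euler-unit {a} p∤a = prime∣-*⇒∣ʳ p-prime p∤a (fermat-half a)

  ^m≡±1 : ∀ {a} → ¬ + p ∣ₛ a → + p ∣ₛ a ^ m - + 1 ⊎ + p ∣ₛ a ^ m + + 1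
  ^m≡±1 {a} p∤a = euclidsLemmaℤ p-prime _ _ (subst (+ p ∣ₛ_) (difference-of-squares (a ^ m)) (euler-unit p∤a))
    where
    difference-of-squares : ∀ e → e * e - + 1 ≡ (e - + 1) * (e + + 1)
    difference-of-squares = solve-∀

  ¬residue⇒nonresidue : ∀ {a} → ¬ + p ∣ₛ a → ¬ + p ∣ₛ a ^ m - + 1 → + p ∣ₛ a ^ m + + 1
  ¬residue⇒nonresidue p∤a p∤aᵐ-1 = [ (λ p∣aᵐ-1 → ⊥-elim (p∤aᵐ-1 p∣aᵐ-1)) , id ]′ (^m≡±1 p∤a)

  nonresidue⇒¬unitSquare : ∀ {x b} → ¬ + p ∣ₛ b → + p ∣ₛ x ^ m + + 1 → ¬ + p ∣ₛ x - b * b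
  nonresidue⇒¬unitSquare {x} {b} p∤b p∣xᵐ+1 p∣x-b² = p∤2 (subst (+ p ∣ₛ_) (two (x ^ m) (b ^ m))
    (∣m∣n⇒∣m-n (∣m∣n⇒∣m-n p∣xᵐ+1 p∣xᵐ-bᵐbᵐ) (euler-unit p∤b)))
    where
    p∣xᵐ-bᵐbᵐ : + p ∣ₛ x ^ m - b ^ m * b ^ m
    p∣xᵐ-bᵐbᵐ = subst (λ e → + p ∣ₛ x ^ m - e) (^-distribʳ-* b b m) (∣m-n⇒∣m^k-n^k m p∣x-b²)
    two : ∀ e f → (e + + 1) - (e - f * f) - (f * f - + 1) ≡ + 2
    two = solve-∀

  hensel⁴ : ∀ {D x} k → ¬ + p ∣ₛ x → + (p ℕ.^ suc k) ∣ₛ D - x * x * x * x →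
    ∃ λ y → (+ (p ℕ.^ suc (suc k)) ∣ₛ D - y * y * y * y) × ¬ + p ∣ₛ y × + (p ℕ.^ suc k) ∣ₛ y - x
  hensel⁴ {D} {x} k p∤x (divides q D-x⁴≡qP) = y , P·p∣D-y⁴ , p∤y , divides (q * W) (difference x P (q * W))
    where
    P : ℤ
    P = + (p ℕ.^ suc k)
    A : ℤ
    A = + 4 * (x * x * x)
    p∤A : ¬ + p ∣ₛ A
    p∤A = prime∤-* p-prime p∤4 (prime∤-* p-prime (prime∤-* p-prime p∤x p∤x) p∤x)
    W : ℤ
    W = proj₁ (modularInverse p-prime p∤A)
    p∣AW-1 : + p ∣ₛ A * W - + 1
    p∣AW-1 = proj₂ (modularInverse p-prime p∤A)
    h : ℤ
    h = P * (q * W)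
    y : ℤ
    y = x + h
    R : ℤ
    R = q * (+ 1 - A * W) - P * ((q * W) * (q * W) * (+ 6 * (x * x) + + 4 * x * h + h * h))
    D-y⁴≡PR : D - y * y * y * y ≡ P * R
    D-y⁴≡PR = begin
      D - y * y * y * y                  ≡⟨ quartic-newton D x q P W ⟩
      (D - x * x * x * x - q * P) + P * R ≡⟨ cong (λ e → e - q * P + P * R) D-x⁴≡qP ⟩
      (q * P - q * P) + P * R            ≡⟨ cong (_+ P * R) (ℤₚ.+-inverseʳ (q * P)) ⟩
      + 0 + P * R                        ≡⟨ ℤₚ.+-identityˡ (P * R) ⟩
      P * R                              ∎
      where open ≡-Reasoning
    p∣R : + p ∣ₛ R
    p∣R = ∣m∣n⇒∣m-n (subst (+ p ∣ₛ_) (negate q (A * W)) (∣n⇒∣m*n (- q) p∣AW-1)) (∣m⇒∣m*n _ (p∣pᵏ⁺¹ p k))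
      where
      negate : ∀ q e → - q * (e - + 1) ≡ q * (+ 1 - e)
      negate = solve-∀
    P·p∣D-y⁴ : + (p ℕ.^ suc (suc k)) ∣ₛ D - y * y * y * y
    P·p∣D-y⁴ = subst₂ _∣ₛ_ (trans (ℤₚ.*-comm P (+ p)) (sym (ℤₚ.pos-* p _))) (sym D-y⁴≡PR) (*-monoʳ-∣ P p∣R)
    p∤y : ¬ + p ∣ₛ y
    p∤y p∣y = p∤x (subst (+ p ∣ₛ_) (cancel x h) (∣m∣n⇒∣m-n p∣y (∣m⇒∣m*n (q * W) (p∣pᵏ⁺¹ p k))))
      where
      cancel : ∀ x h → x + h - h ≡ x
      cancel = solve-∀
    difference : ∀ x P d → x + P * d - x ≡ d * P
    difference = solve-∀

  qpPoint : ∀ {C z s t} → ¬ + p ∣ₛ z → + p ∣ₛ curveEq C z s t → HasQpPoint C p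
  qpPoint {C} {z} {s} {t} p∤z p∣F =
    zₖ , (λ _ → s) , (λ _ → t) , zₖ-Zp , constantZp p s , constantZp p t , root , unit
    where
    D : ℤ
    D = C * (s * s) - + 4 * (t * t * t * t)
    F≡D-z⁴ : ∀ z → curveEq C z s t ≡ D - z * z * z * z
    F≡D-z⁴ z = trans (curveEq-expand C z s t) (regroup C (s * s) (z * z * z * z) (t * t * t * t))
      where
      regroup : ∀ C S Z T → C * S - (Z + + 4 * T) ≡ C * S - + 4 * T - Z
      regroup = solve-∀
    Root : ℕ → ℤ → Set
    Root k x = (+ (p ℕ.^ suc k) ∣ₛ D - x * x * x * x) × ¬ + p ∣ₛ x
    Root₀ : Root 0 z
    Root₀ = subst₂ _∣ₛ_ (sym (ℤₚ.*-identityʳ (+ p))) (F≡D-z⁴ z) p∣F , p∤z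
    lift : ∀ k {x} → Root k x → ∃ λ y → Root (suc k) y × + (p ℕ.^ k) ∣ₛ y - x
    lift k (p∣D-x⁴ , p∤x) =
      let (y , p∣D-y⁴ , p∤y , y≡x) = hensel⁴ {D} k p∤x p∣D-x⁴
      in y , (p∣D-y⁴ , p∤y) , ∣-trans (pᵏ∣pⁿ⁺ᵏ p 1 k) y≡x
    sequence : ∃ λ (z : ℕ → ℤ) → IsZp p z × (∀ k → Root k (z k))
    sequence = coherentSequence Root Root₀ lift
    zₖ : ℕ → ℤ
    zₖ = proj₁ sequence
    zₖ-Zp : IsZp p zₖ
    zₖ-Zp = proj₁ (proj₂ sequence)
    root : ∀ k → curveEq C (zₖ k) s t ≡ + 0 [mod + (p ℕ.^ k) ]
    root k = ∣⇒∣ᵤ (subst₂ _∣ₛ_ refl (trans (sym (F≡D-z⁴ (zₖ k))) (sym (ℤₚ.+-identityʳ _)))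
      (∣-trans (pᵏ∣pⁿ⁺ᵏ p 1 k) (proj₁ (proj₂ (proj₂ sequence) k))))
    unit : + p ∣ zₖ 1 → + p ∣ t → ⊥
    unit p∣z₁ _ = proj₂ (proj₂ (proj₂ sequence) 1) (∣ᵤ⇒∣ p∣z₁)

  qpPoint-⁴√-4 : ∀ {C z} s → + p ∣ₛ z * z * z * z + + 4 → + p ∣ₛ C * (s * s) → HasQpPoint C p
  qpPoint-⁴√-4 {C} {z} s p∣z⁴+4 p∣Cs² =
    qpPoint {C} {z} {s} {+ 1} p∤z (subst (+ p ∣ₛ_) (sym F≡Cs²-[z⁴+4]) (∣m∣n⇒∣m-n p∣Cs² p∣z⁴+4))
    where
    F≡Cs²-[z⁴+4] : curveEq C z s (+ 1) ≡ C * (s * s) - (z * z * z * z + + 4)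
    F≡Cs²-[z⁴+4] = curveEq-expand C z s (+ 1)
    p∤z : ¬ + p ∣ₛ z
    p∤z p∣z = p∤4 (subst (+ p ∣ₛ_) (cancel (z * z * z * z)) (∣m∣n⇒∣m-n p∣z⁴+4 (∣⇒∣⁴ p∣z)))
      where
      cancel : ∀ a → a + + 4 - a ≡ + 4
      cancel = solve-∀

pos-2^[n+k] : ∀ n k → + (2 ℕ.^ (n ℕ.+ k)) ≡ + (2 ℕ.^ n) * + (2 ℕ.^ k)
pos-2^[n+k] n k = trans (cong +_ (ℕₚ.^-distribˡ-+-* 2 n k)) (ℤₚ.pos-* (2 ℕ.^ n) (2 ℕ.^ k))

-- The prime 2

8∣C-5⇒4∣C-1 : ∀ {C} → + 8 ∣ₛ C - + 5 → + 4 ∣ₛ C - + 1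
8∣C-5⇒4∣C-1 {C} 8∣C-5 = subst (+ 4 ∣ₛ_) (shift C) (∣m∣n⇒∣m+n (∣-trans (divides (+ 2) refl) 8∣C-5) ∣-refl)
  where
  shift : ∀ C → C - + 5 + + 4 ≡ C - + 1
  shift = solve-∀

2∣1+ab : ∀ {a b} → + 2 ∣ₛ a - + 1 → + 2 ∣ₛ b - + 1 → + 2 ∣ₛ + 1 + a * b
2∣1+ab {a} {b} 2∣a-1 2∣b-1 =
  subst (+ 2 ∣ₛ_) (expand a b) (∣m∣n⇒∣m+n (∣m∣n⇒∣m+n (∣m⇒∣m*n b 2∣a-1) 2∣b-1) (divides (+ 1) refl))
  where
  expand : ∀ a b → (a - + 1) * b + (b - + 1) + + 2 ≡ + 1 + a * b
  expand = solve-∀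

-- Newton's step y = s + (As² − B)/2 for a root of As² − B, where As² − B = 8Ge; the term linear
-- in the correction carries the factor 1 + As, which is even.
square-newton : ∀ A B s e c G →
  A * ((s + + 4 * G * e) * (s + + 4 * G * e)) - B
  ≡ (A * (s * s) - B - e * (+ 8 * G)) + e * (+ 8 * G) * ((+ 1 + A * s) - c * + 2)
    + (e * c + A * G * (e * e)) * (+ 16 * G)
square-newton = solve-∀

hensel² : ∀ {A B s} k → + 2 ∣ₛ A - + 1 → + 2 ∣ₛ s - + 1 → + (2 ℕ.^ (3 ℕ.+ k)) ∣ₛ A * (s * s) - B →
  ∃ λ y → (+ (2 ℕ.^ (4 ℕ.+ k)) ∣ₛ A * (y * y) - B) × + 2 ∣ₛ y - + 1 × + (2 ℕ.^ (2 ℕ.+ k)) ∣ₛ y - s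
hensel² {A} {B} {s} k 2∣A-1 2∣s-1 (divides e As²-B≡e·8G) with 2∣1+ab {A} {s} 2∣A-1 2∣s-1
... | divides c 1+As≡c·2 =
  y , divides (e * c + A * G * (e * e)) Ay²-B≡[…]·16G , 2∣y-1 ,
  divides e (trans (difference s (+ 4 * G) e) (cong (e *_) (sym (pos-2^[n+k] 2 k))))
  where
  G : ℤ
  G = + (2 ℕ.^ k)
  y : ℤ
  y = s + + 4 * G * e
  Ay²-B≡[…]·16G : A * (y * y) - B ≡ (e * c + A * G * (e * e)) * + (2 ℕ.^ (4 ℕ.+ k))
  Ay²-B≡[…]·16G = begin
    A * (y * y) - B
      ≡⟨ square-newton A B s e c G ⟩
    (A * (s * s) - B - e * (+ 8 * G)) + e * (+ 8 * G) * ((+ 1 + A * s) - c * + 2) + Q * (+ 16 * G)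
      ≡⟨ cong₂ (λ u v → (u - e * (+ 8 * G)) + e * (+ 8 * G) * (v - c * + 2) + Q * (+ 16 * G))
           (trans As²-B≡e·8G (cong (e *_) (pos-2^[n+k] 3 k))) 1+As≡c·2 ⟩
    (e * (+ 8 * G) - e * (+ 8 * G)) + e * (+ 8 * G) * (c * + 2 - c * + 2) + Q * (+ 16 * G)
      ≡⟨ cancel (e * (+ 8 * G)) (c * + 2) (Q * (+ 16 * G)) ⟩
    Q * (+ 16 * G)
      ≡⟨ cong (Q *_) (sym (pos-2^[n+k] 4 k)) ⟩
    Q * + (2 ℕ.^ (4 ℕ.+ k)) ∎
    where
    open ≡-Reasoning
    Q : ℤ
    Q = e * c + A * G * (e * e)
    cancel : ∀ a b r → (a - a) + a * (b - b) + r ≡ r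
    cancel = solve-∀
  2∣y-1 : + 2 ∣ₛ y - + 1
  2∣y-1 = subst (+ 2 ∣ₛ_) (shift s (+ 4 * G * e)) (∣m∣n⇒∣m+n 2∣s-1 (∣m⇒∣m*n e (∣m⇒∣m*n G (divides (+ 2) refl))))
    where
    shift : ∀ s d → s - + 1 + d ≡ s + d - + 1
    shift = solve-∀
  difference : ∀ x P d → x + P * d - x ≡ d * P
  difference = solve-∀

qpPoint₂ : ∀ {C} → + 8 ∣ₛ C - + 5 → HasQpPoint C 2
qpPoint₂ {C} 8∣C-5 =
  (λ _ → + 1) , sₖ , (λ _ → + 1) , constantZp 2 (+ 1) , sₖ-Zp , constantZp 2 (+ 1) , root , unit
  where
  F≡Cs²-5 : ∀ s → curveEq C (+ 1) s (+ 1) ≡ C * (s * s) - + 5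
  F≡Cs²-5 s = curveEq-expand C (+ 1) s (+ 1)
  2∣C-1 : + 2 ∣ₛ C - + 1
  2∣C-1 = ∣-trans (divides (+ 2) refl) (8∣C-5⇒4∣C-1 {C} 8∣C-5)
  Root : ℕ → ℤ → Set
  Root k s = (+ (2 ℕ.^ (3 ℕ.+ k)) ∣ₛ C * (s * s) - + 5) × + 2 ∣ₛ s - + 1
  Root₀ : Root 0 (+ 1)
  Root₀ = subst (λ e → + 8 ∣ₛ e - + 5) (sym (ℤₚ.*-identityʳ C)) 8∣C-5 , divides (+ 0) refl
  lift : ∀ k {s} → Root k s → ∃ λ y → Root (suc k) y × + (2 ℕ.^ k) ∣ₛ y - s
  lift k {s} (2ᵏ⁺³∣Cs²-5 , 2∣s-1) =
    let (y , 2ᵏ⁺⁴∣Cy²-5 , 2∣y-1 , y≡s) = hensel² {C} {+ 5} {s} k 2∣C-1 2∣s-1 2ᵏ⁺³∣Cs²-5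
    in y , (2ᵏ⁺⁴∣Cy²-5 , 2∣y-1) , ∣-trans (pᵏ∣pⁿ⁺ᵏ 2 2 k) y≡s
  sequence : ∃ λ (s : ℕ → ℤ) → IsZp 2 s × (∀ k → Root k (s k))
  sequence = coherentSequence Root {+ 1} Root₀ lift
  sₖ : ℕ → ℤ
  sₖ = proj₁ sequence
  sₖ-Zp : IsZp 2 sₖ
  sₖ-Zp = proj₁ (proj₂ sequence)
  root : ∀ k → curveEq C (+ 1) (sₖ k) (+ 1) ≡ + 0 [mod + (2 ℕ.^ k) ]
  root k = ∣⇒∣ᵤ (subst₂ _∣ₛ_ refl (trans (sym (F≡Cs²-5 (sₖ k))) (sym (ℤₚ.+-identityʳ _)))
    (∣-trans (pᵏ∣pⁿ⁺ᵏ 2 3 k) (proj₁ (proj₂ (proj₂ sequence) k))))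
  unit : + 2 ∣ + 1 → + 2 ∣ + 1 → ⊥
  unit 2∣1 _ = ∤-small {2} {1} (s≤s z≤n) (s≤s (s≤s z≤n)) (∣ᵤ⇒∣ 2∣1)

-- Lagrange's theorem, nonresidues and primes p ≡ 1 (mod 4)

prime∤1 : ∀ {p} → Prime p → ¬ + p ∣ₛ + 1
prime∤1 {suc (suc _)} _ = ∤-small (s≤s z≤n) (s≤s (s≤s z≤n))

-- A monic polynomial xⁿ + cₙ₋₁xⁿ⁻¹ + … + c₀ is represented by its lower coefficients c₀ ∷ … ∷ cₙ₋₁.
evalMonic : ∀ {n} → Vec ℤ n → ℤ → ℤ
evalMonic [] x = + 1
evalMonic (c ∷ cs) x = c + x * evalMonic cs x

divideMonic : ∀ {n} → Vec ℤ (suc n) → ℤ → Vec ℤ n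
divideMonic (c ∷ []) a = []
divideMonic (c ∷ d ∷ cs) a = evalMonic (d ∷ cs) a ∷ divideMonic (d ∷ cs) a

evalMonic-divide : ∀ {n} (f : Vec ℤ (suc n)) a x →
  evalMonic f x ≡ (x - a) * evalMonic (divideMonic f a) x + evalMonic f a
evalMonic-divide (c ∷ []) a x = linear c a x
  where
  linear : ∀ c a x → c + x * + 1 ≡ (x - a) * + 1 + (c + a * + 1)
  linear = solve-∀
evalMonic-divide (c ∷ g@(_ ∷ _)) a x =
  trans (cong (λ e → c + x * e) (evalMonic-divide g a x)) (regroup c a x (evalMonic (divideMonic g a) x) (evalMonic g a))
  where
  regroup : ∀ c a x q r → c + x * ((x - a) * q + r) ≡ (x - a) * (r + x * q) + (c + a * r)
  regroup = solve-∀

lagrange : ∀ {p n} → Prime p → (f : Vec ℤ n) (x : Fin (suc n) → ℤ) →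
  (∀ i j → i ≢ j → ¬ + p ∣ₛ x i - x j) → ∃ λ i → ¬ + p ∣ₛ evalMonic f (x i)
lagrange p-prime [] x _ = zero , prime∤1 p-prime
lagrange {p} p-prime f@(_ ∷ _) x distinct with + p ∣? evalMonic f (x zero)
... | no p∤f[x₀] = zero , p∤f[x₀]
... | yes p∣f[x₀] with lagrange p-prime (divideMonic f (x zero)) (λ i → x (suc i))
                         (λ i j i≢j → distinct (suc i) (suc j) (λ eq → i≢j (suc-injective eq)))
...   | i , p∤g[xᵢ] = suc i , p∤f[xᵢ]
  where
  p∤f[xᵢ] : ¬ + p ∣ₛ evalMonic f (x (suc i))
  p∤f[xᵢ] p∣f[xᵢ] = prime∤-* p-prime (distinct (suc i) zero (λ ())) p∤g[xᵢ]
    (subst (+ p ∣ₛ_) (cancel (xᵢ - x₀) (evalMonic g xᵢ) (evalMonic f x₀))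
      (∣m∣n⇒∣m-n (subst (+ p ∣ₛ_) (evalMonic-divide f x₀ xᵢ) p∣f[xᵢ]) p∣f[x₀]))
    where
    x₀ xᵢ : ℤ
    x₀ = x zero
    xᵢ = x (suc i)
    g : Vec ℤ _
    g = divideMonic f x₀
    cancel : ∀ d g r → d * g + r - r ≡ d * g
    cancel = solve-∀

p∤distance : ∀ {p a b} → a ℕ.< b → b ℕ.< p → ¬ p ℕ.∣ ℤ.∣ + a - + b ∣
p∤distance {p} {a} {b} a<b b<p p∣∣a-b∣ =
  ∤-small (ℕₚ.m<n⇒0<n∸m a<b) (ℕₚ.≤-<-trans (ℕₚ.m∸n≤m b a) b<p)
    (∣ᵤ⇒∣ (subst (p ℕ.∣_) (trans (cong ℤ.∣_∣ (ℤₚ.m-n≡m⊖n a b)) (ℤₚ.∣⊖∣-< a<b)) p∣∣a-b∣))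

incongruent : ∀ {p a b} → a ≢ b → a ℕ.< p → b ℕ.< p → ¬ + p ∣ₛ + a - + b
incongruent {p} {a} {b} a≢b a<p b<p p∣a-b with ℕₚ.<-cmp a b
... | tri< a<b _ _ = p∤distance a<b b<p (∣⇒∣ᵤ p∣a-b)
... | tri≈ _ a≡b _ = a≢b a≡b
... | tri> _ _ b<a = p∤distance b<a a<p (subst (p ℕ.∣_) (ℤₚ.∣i-j∣≡∣j-i∣ (+ a) (+ b)) (∣⇒∣ᵤ p∣a-b))

evalMonic-replicate : ∀ n x → evalMonic (replicate n (+ 0)) x ≡ x ^ n
evalMonic-replicate zero x = refl
evalMonic-replicate (suc n) x = trans (ℤₚ.+-identityˡ _) (cong (x *_) (evalMonic-replicate n x))

nonresidue : ∀ {m} → Prime (suc (m ℕ.+ m)) → ∃ λ x → + suc (m ℕ.+ m) ∣ₛ x ^ m + + 1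
nonresidue {suc m} p-prime =
  point i , nonroot⇒nonresidue (∤-small (s≤s z≤n) (point<p i)) p∤f[xᵢ]
  where
  open OddPrime {suc m} p-prime
  p : ℕ
  p = suc (suc m ℕ.+ suc m)
  f : Vec ℤ (suc m)
  f = - + 1 ∷ replicate m (+ 0)
  point : Fin (suc (suc m)) → ℤ
  point i = + suc (toℕ i)
  point<p : ∀ i → suc (toℕ i) ℕ.< p
  point<p i = s≤s (ℕₚ.<-≤-trans (toℕ<n i) (s≤s (ℕₚ.m≤n+m (suc m) m)))
  distinct : ∀ i j → i ≢ j → ¬ + p ∣ₛ point i - point j
  distinct i j i≢j = incongruent (λ eq → i≢j (toℕ-injective (ℕₚ.suc-injective eq))) (point<p i) (point<p j)
  nonroot⇒nonresidue : ∀ {x} → ¬ + p ∣ₛ x → ¬ + p ∣ₛ evalMonic f x → + p ∣ₛ x ^ suc m + + 1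
  nonroot⇒nonresidue {x} p∤x p∤f[x] =
    ¬residue⇒nonresidue p∤x (λ p∣xᵐ-1 → p∤f[x] (subst (+ p ∣ₛ_) xᵐ-1≡f[x] p∣xᵐ-1))
    where
    xᵐ-1≡f[x] : x ^ suc m - + 1 ≡ evalMonic f x
    xᵐ-1≡f[x] = trans (ℤₚ.+-comm (x ^ suc m) (- + 1)) (cong (λ e → - + 1 + x * e) (sym (evalMonic-replicate m x)))
  found : ∃ λ i → ¬ + p ∣ₛ evalMonic f (point i)
  found = lagrange p-prime f point distinct
  i : Fin (suc (suc m))
  i = proj₁ found
  p∤f[xᵢ] : ¬ + p ∣ₛ evalMonic f (point i)
  p∤f[xᵢ] = proj₂ found

qpPoint-1mod4 : ∀ {k C} → Prime (suc ((k ℕ.+ k) ℕ.+ (k ℕ.+ k))) → HasQpPoint C (suc ((k ℕ.+ k) ℕ.+ (k ℕ.+ k)))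
qpPoint-1mod4 {k} {C} p-prime = qpPoint-⁴√-4 {C} {+ 1 + i} (+ 0) p∣z⁴+4 (∣n⇒∣m*n C (divides (+ 0) refl))
  where
  open OddPrime {k ℕ.+ k} p-prime using (qpPoint-⁴√-4)
  x : ℤ
  x = proj₁ (nonresidue {k ℕ.+ k} p-prime)
  i : ℤ
  i = x ^ k
  p∣i²+1 : _ ∣ₛ i * i + + 1
  p∣i²+1 = subst (_ ∣ₛ_) (cong (_+ + 1) (ℤₚ.^-distribˡ-+-* x k k)) (proj₂ (nonresidue {k ℕ.+ k} p-prime))
  p∣z⁴+4 : _ ∣ₛ (+ 1 + i) * (+ 1 + i) * (+ 1 + i) * (+ 1 + i) + + 4
  p∣z⁴+4 = subst (_ ∣ₛ_) (factor i) (∣m⇒∣m*n (i * i + + 4 * i + + 5) p∣i²+1)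
    where
    factor : ∀ i → (i * i + + 1) * (i * i + + 4 * i + + 5) ≡ (+ 1 + i) * (+ 1 + i) * (+ 1 + i) * (+ 1 + i) + + 4
    factor = solve-∀

-- Primes p ≡ 3 (mod 4)

⁴√-4⇒∣z⁴+4 : ∀ {p} → IsFourthPowerMod (- + 4) p → ∃ λ z → + p ∣ₛ z * z * z * z + + 4
⁴√-4⇒∣z⁴+4 (z , z⁴≡-4) = z , subst (_ ∣ₛ_) (cong (_+ + 4) (x^4≡x*x*x*x z)) (∣ᵤ⇒∣ z⁴≡-4)

[-1]^[n+n]≡1 : ∀ n → (- + 1) ^ (n ℕ.+ n) ≡ + 1
[-1]^[n+n]≡1 zero = refl
[-1]^[n+n]≡1 (suc n) = cong (λ e → - + 1 * e) (trans (cong ((- + 1) ^_) (ℕₚ.+-suc n n)) (cong (- + 1 *_) ([-1]^[n+n]≡1 n)))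

module Prime≡3mod4 {r} (p-prime : Prime (suc (suc (r ℕ.+ r) ℕ.+ suc (r ℕ.+ r)))) where
  open OddPrime {suc (r ℕ.+ r)} p-prime

  private
    m : ℕ
    m = suc (r ℕ.+ r)
    p : ℕ
    p = suc (m ℕ.+ m)

  √_ : ℤ → ℤ
  √ x = x ^ suc r

  √x·√x≡x·xᵐ : ∀ x → √ x * √ x ≡ x * x ^ m
  √x·√x≡x·xᵐ x = trans (sym (ℤₚ.^-distribˡ-+-* x (suc r) (suc r))) (cong (λ n → x ^ suc n) (ℕₚ.+-suc r r))

  residue⇒√ : ∀ {x} → + p ∣ₛ x * (x ^ m - + 1) → + p ∣ₛ √ x * √ x - x
  residue⇒√ {x} = subst (+ p ∣ₛ_) (trans (factor x (x ^ m)) (cong (_- x) (sym (√x·√x≡x·xᵐ x))))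
    where
    factor : ∀ x e → x * (e - + 1) ≡ x * e - x
    factor = solve-∀

  √v⁴≡v² : ∀ v → + p ∣ₛ √ v * √ v * √ v * √ v - v * v
  √v⁴≡v² v = subst (+ p ∣ₛ_) (sym (trans (regroup (√ v) (v * v)) (cong (λ e → e * e - v * v) (√x·√x≡x·xᵐ v))))
    (subst (+ p ∣ₛ_) (expand v (v ^ m)) (∣n⇒∣m*n v (fermat-half v)))
    where
    regroup : ∀ w u → w * w * w * w - u ≡ (w * w) * (w * w) - u
    regroup = solve-∀
    expand : ∀ v e → v * (v * (e * e - + 1)) ≡ v * e * (v * e) - v * v
    expand = solve-∀

  -a²-nonresidue : ∀ {a} → ¬ + p ∣ₛ a → + p ∣ₛ (- (a * a)) ^ m + + 1
  -a²-nonresidue {a} p∤a = subst (+ p ∣ₛ_) (sym -a²ᵐ+1≡…) (∣m⇒∣-m (euler-unit p∤a))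
    where
    [-1]ᵐ≡-1 : (- + 1) ^ m ≡ - + 1
    [-1]ᵐ≡-1 = cong (- + 1 *_) ([-1]^[n+n]≡1 r)
    -a²-as-product : - (a * a) ≡ - + 1 * (a * a)
    -a²-as-product = sym (ℤₚ.-1*i≡-i (a * a))
    -a²ᵐ+1≡… : (- (a * a)) ^ m + + 1 ≡ - (a ^ m * a ^ m - + 1)
    -a²ᵐ+1≡… = begin
      (- (a * a)) ^ m + + 1                  ≡⟨ cong (λ e → e ^ m + + 1) -a²-as-product ⟩
      (- + 1 * (a * a)) ^ m + + 1            ≡⟨ cong (_+ + 1) (^-distribʳ-* (- + 1) (a * a) m) ⟩
      (- + 1) ^ m * (a * a) ^ m + + 1        ≡⟨ cong₂ (λ u v → u * v + + 1) [-1]ᵐ≡-1 (^-distribʳ-* a a m) ⟩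
      - + 1 * (a ^ m * a ^ m) + + 1          ≡⟨ negate (a ^ m * a ^ m) ⟩
      - (a ^ m * a ^ m - + 1)                ∎
      where
      open ≡-Reasoning
      negate : ∀ e → - + 1 * e + + 1 ≡ - (e - + 1)
      negate = solve-∀

  -4-nonsquare : ∀ v → ¬ + p ∣ₛ v * v + + 4
  -4-nonsquare v p∣v²+4 = nonresidue⇒¬unitSquare {x = - (+ 2 * + 2)} {b = v} p∤v (-a²-nonresidue {+ 2} p∤2)
    (subst (+ p ∣ₛ_) (negate v) (∣m⇒∣-m p∣v²+4))
    where
    p∤v : ¬ + p ∣ₛ v
    p∤v p∣v = p∤4 (subst (+ p ∣ₛ_) (cancel v) (∣m∣n⇒∣m-n p∣v²+4 (∣n⇒∣m*n v p∣v)))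
      where
      cancel : ∀ v → v * v + + 4 - v * v ≡ + 4
      cancel = solve-∀
    negate : ∀ v → - (v * v + + 4) ≡ - (+ 2 * + 2) - v * v
    negate = solve-∀

  nonresidue-* : ∀ {x y} → + p ∣ₛ x ^ m + + 1 → + p ∣ₛ y ^ m + + 1 → + p ∣ₛ (x * y) ^ m - + 1
  nonresidue-* {x} {y} p∣xᵐ+1 p∣yᵐ+1 =
    subst (+ p ∣ₛ_) (trans (expand (x ^ m) (y ^ m)) (cong (_- + 1) (sym (^-distribʳ-* x y m))))
      (∣m∣n⇒∣m-n (∣m∣n⇒∣m-n (∣n⇒∣m*n (x ^ m + + 1) p∣yᵐ+1) p∣xᵐ+1) p∣yᵐ+1)
    where
    expand : ∀ a b → (a + + 1) * (b + + 1) - (a + + 1) - (b + + 1) ≡ a * b - + 1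
    expand = solve-∀

  nonresidue-or-square : ∀ x → + p ∣ₛ x ^ m + + 1 ⊎ + p ∣ₛ √ x * √ x - x
  nonresidue-or-square x with + p ∣? x ^ m + + 1
  ... | yes p∣xᵐ+1 = inj₁ p∣xᵐ+1
  ... | no p∤xᵐ+1 =
    inj₂ (residue⇒√ {x} (prime∣-*⇒∣ˡ p-prime p∤xᵐ+1 (subst (+ p ∣ₛ_) (factor x (x ^ m)) (fermat-half x))))
    where
    factor : ∀ x e → x * (e * e - + 1) ≡ x * (e - + 1) * (e + + 1)
    factor = solve-∀

  -- If no w⁴ + 4 is a nonresidue then every 4k is a square: from v² ≡ 4k, the fourth power of
  -- w = √ v is 4k, so w⁴ + 4 ≡ 4(k + 1) is a square.  At k = p − 1 this contradicts -4-nonsquare.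
  quarticNonresidue-or-4k-square : ∀ k →
    (∃ λ w → + p ∣ₛ (w * w * w * w + + 4) ^ m + + 1) ⊎ (∃ λ v → + p ∣ₛ v * v - + 4 * + k)
  quarticNonresidue-or-4k-square zero = inj₂ (+ 0 , divides (+ 0) refl)
  quarticNonresidue-or-4k-square (suc k) = [ inj₁ , next ]′ (quarticNonresidue-or-4k-square k)
    where
    next : (∃ λ v → + p ∣ₛ v * v - + 4 * + k) →
      (∃ λ w → + p ∣ₛ (w * w * w * w + + 4) ^ m + + 1) ⊎ (∃ λ v → + p ∣ₛ v * v - + 4 * + suc k)
    next (v , p∣v²-4k) = [ (λ p∣Xᵐ+1 → inj₁ (w , p∣Xᵐ+1)) , (λ p∣√X²-X → inj₂ (√ X , square p∣√X²-X)) ]′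
                           (nonresidue-or-square X)
      where
      w : ℤ
      w = √ v
      X : ℤ
      X = w * w * w * w + + 4
      square : + p ∣ₛ √ X * √ X - X → + p ∣ₛ √ X * √ X - + 4 * + suc k
      square p∣√X²-X = subst (+ p ∣ₛ_) (telescope (√ X * √ X) w (v * v) (+ k))
        (∣m∣n⇒∣m+n (∣m∣n⇒∣m+n p∣√X²-X (√v⁴≡v² v)) p∣v²-4k)
        where
        telescope : ∀ y w v² k → (y - (w * w * w * w + + 4)) + (w * w * w * w - v²) + (v² - + 4 * k) ≡ y - + 4 * (+ 1 + k)
        telescope = solve-∀

  quarticNonresidue : ∃ λ w → + p ∣ₛ (w * w * w * w + + 4) ^ m + + 1
  quarticNonresidue = [ id , (λ (v , p∣v²-4[p-1]) → ⊥-elim (-4-nonsquare v (p∣v²+4 v p∣v²-4[p-1]))) ]′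
    (quarticNonresidue-or-4k-square (m ℕ.+ m))
    where
    p∣v²+4 : ∀ v → + p ∣ₛ v * v - + 4 * + (m ℕ.+ m) → + p ∣ₛ v * v + + 4
    p∣v²+4 v p∣v²-4[p-1] =
      subst (+ p ∣ₛ_) (shift v (+ (m ℕ.+ m))) (∣m∣n⇒∣m+n p∣v²-4[p-1] (∣n⇒∣m*n (+ 4) ∣-refl))
      where
      shift : ∀ v n → (v * v - + 4 * n) + + 4 * (+ 1 + n) ≡ v * v + + 4
      shift = solve-∀

  qpPoint-residue : ∀ {C} → ¬ + p ∣ₛ C → + p ∣ₛ C ^ m - + 1 → HasQpPoint C p
  qpPoint-residue {C} p∤C p∣Cᵐ-1 = qpPoint {C} {z} {+ 1} {+ 0} p∤z (subst (+ p ∣ₛ_) (sym F≡C-z⁴) (∣m⇒∣-m p∣z⁴-C))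
    where
    z : ℤ
    z = √ (√ C)
    p∣z⁴-C : + p ∣ₛ z * z * z * z - C
    p∣z⁴-C = subst (+ p ∣ₛ_) (telescope (z * z * z * z) (√ C * √ C) C)
      (∣m∣n⇒∣m+n (√v⁴≡v² (√ C)) (residue⇒√ {C} (∣n⇒∣m*n C p∣Cᵐ-1)))
      where
      telescope : ∀ a b c → (a - b) + (b - c) ≡ a - c
      telescope = solve-∀
    F≡C-z⁴ : curveEq C z (+ 1) (+ 0) ≡ - (z * z * z * z - C)
    F≡C-z⁴ = trans (curveEq-expand C z (+ 1) (+ 0)) (simplify C (z * z * z * z))
      where
      simplify : ∀ C Z → C * (+ 1 * + 1) - (Z + + 4 * (+ 0 * + 0 * + 0 * + 0)) ≡ - (Z - C)
      simplify = solve-∀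
    p∤z : ¬ + p ∣ₛ z
    p∤z p∣z = p∤C (subst (+ p ∣ₛ_) (cancel (z * z * z * z) C) (∣m∣n⇒∣m-n (∣⇒∣⁴ p∣z) p∣z⁴-C))
      where
      cancel : ∀ a c → a - (a - c) ≡ c
      cancel = solve-∀

  qpPoint-nonresidue : ∀ {C} → ¬ + p ∣ₛ C → + p ∣ₛ C ^ m + + 1 → HasQpPoint C p
  qpPoint-nonresidue {C} p∤C p∣Cᵐ+1 = qpPoint {C} {C * w} {C * u} {C} (prime∤-* p-prime p∤C p∤w)
    (subst (+ p ∣ₛ_) (sym F≡C³[u²-CK]) (∣n⇒∣m*n (C * C * C) p∣u²-CK))
    where
    w : ℤ
    w = proj₁ quarticNonresidue
    K : ℤ
    K = w * w * w * w + + 4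
    p∣Kᵐ+1 : + p ∣ₛ K ^ m + + 1
    p∣Kᵐ+1 = proj₂ quarticNonresidue
    u : ℤ
    u = √ (C * K)
    p∣u²-CK : + p ∣ₛ u * u - C * K
    p∣u²-CK = residue⇒√ {C * K} (∣n⇒∣m*n (C * K) (nonresidue-* {C} {K} p∣Cᵐ+1 p∣Kᵐ+1))
    F≡C³[u²-CK] : curveEq C (C * w) (C * u) C ≡ C * C * C * (u * u - C * K)
    F≡C³[u²-CK] = trans (curveEq-expand C (C * w) (C * u) C) (expand C w u)
      where
      expand : ∀ C w u → C * ((C * u) * (C * u)) - ((C * w) * (C * w) * (C * w) * (C * w) + + 4 * (C * C * C * C))
        ≡ C * C * C * (u * u - C * (w * w * w * w + + 4))
      expand = solve-∀
    p∤w : ¬ + p ∣ₛ w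
    p∤w p∣w = nonresidue⇒¬unitSquare {K} {+ 2} p∤2 p∣Kᵐ+1
      (subst (+ p ∣ₛ_) (shift (w * w * w * w)) (∣⇒∣⁴ p∣w))
      where
      shift : ∀ a → a ≡ a + + 4 - + 2 * + 2
      shift = solve-∀

  qpPoint-3mod4 : ∀ {C} → (+ p ∣ C → IsFourthPowerMod (- + 4) p) → HasQpPoint C p
  qpPoint-3mod4 {C} fourthRoot with + p ∣? C
  ... | no p∤C = [ qpPoint-residue p∤C , qpPoint-nonresidue p∤C ]′ (^m≡±1 p∤C)
  ... | yes p∣C = let (z , p∣z⁴+4) = ⁴√-4⇒∣z⁴+4 {p} (fourthRoot (∣⇒∣ᵤ p∣C))
                  in qpPoint-⁴√-4 {C} {z} (+ 1) p∣z⁴+4 (∣m⇒∣m*n (+ 1 * + 1) p∣C)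

-- Residues modulo 4 and the sign of C

%4≡3⇒shape : ∀ {n} → n % 4 ≡ 3 → ∃ λ r → n ≡ suc (suc (r ℕ.+ r) ℕ.+ suc (r ℕ.+ r))
%4≡3⇒shape {n} n%4≡3 = n / 4 , trans (m≡m%n+[m/n]*n n 4) (trans (cong (ℕ._+ n / 4 ℕ.* 4) n%4≡3) (shape (n / 4)))
  where
  shape : ∀ r → 3 ℕ.+ r ℕ.* 4 ≡ suc (suc (r ℕ.+ r) ℕ.+ suc (r ℕ.+ r))
  shape = ℕ-Solver.solve-∀

oddPrime-mod4 : ∀ {p} → Prime p → p ≢ 2 →
  (∃ λ k → p ≡ suc ((k ℕ.+ k) ℕ.+ (k ℕ.+ k))) ⊎ (∃ λ r → p ≡ suc (suc (r ℕ.+ r) ℕ.+ suc (r ℕ.+ r)))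
oddPrime-mod4 {p} p-prime p≢2 = classify (p % 4) (p / 4) (m%n<n p 4) (m≡m%n+[m/n]*n p 4)
  where
  2∤p : ¬ 2 ℕ.∣ p
  2∤p 2∣p = [ (λ ()) , (λ 2≡p → p≢2 (sym 2≡p)) ]′ (prime⇒irreducible p-prime 2∣p)
  classify : ∀ a q → a ℕ.< 4 → p ≡ a ℕ.+ q ℕ.* 4 →
    (∃ λ k → p ≡ suc ((k ℕ.+ k) ℕ.+ (k ℕ.+ k))) ⊎ (∃ λ r → p ≡ suc (suc (r ℕ.+ r) ℕ.+ suc (r ℕ.+ r)))
  classify 0 q _ p≡4q = ⊥-elim (2∤p (ℕ.divides (q ℕ.* 2) (trans p≡4q (even q))))
    where
    even : ∀ q → 0 ℕ.+ q ℕ.* 4 ≡ q ℕ.* 2 ℕ.* 2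
    even = ℕ-Solver.solve-∀
  classify 1 q _ p≡1+4q = inj₁ (q , trans p≡1+4q (shape q))
    where
    shape : ∀ q → 1 ℕ.+ q ℕ.* 4 ≡ suc ((q ℕ.+ q) ℕ.+ (q ℕ.+ q))
    shape = ℕ-Solver.solve-∀
  classify 2 q _ p≡2+4q = ⊥-elim (2∤p (ℕ.divides (suc (q ℕ.* 2)) (trans p≡2+4q (even q))))
    where
    even : ∀ q → 2 ℕ.+ q ℕ.* 4 ≡ suc (q ℕ.* 2) ℕ.* 2
    even = ℕ-Solver.solve-∀
  classify 3 q _ p≡3+4q = inj₂ (q , trans p≡3+4q (shape q))
    where
    shape : ∀ q → 3 ℕ.+ q ℕ.* 4 ≡ suc (suc (q ℕ.+ q) ℕ.+ suc (q ℕ.+ q))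
    shape = ℕ-Solver.solve-∀
  classify (suc (suc (suc (suc _)))) _ (s≤s (s≤s (s≤s (s≤s ())))) _

%4≡3-* : ∀ a b → (a ℕ.* b) % 4 ≡ 3 → a % 4 ≡ 3 ⊎ b % 4 ≡ 3
%4≡3-* a b ab%4≡3 = residues (a % 4) (b % 4) (m%n<n a 4) (m%n<n b 4) (trans (sym (%-distribˡ-* a b 4)) ab%4≡3)
  where
  residues : ∀ x y → x ℕ.< 4 → y ℕ.< 4 → (x ℕ.* y) % 4 ≡ 3 → x ≡ 3 ⊎ y ≡ 3
  residues 3 _ _ _ _ = inj₁ refl
  residues _ 3 _ _ _ = inj₂ refl
  residues 0 0 _ _ ()
  residues 0 1 _ _ ()
  residues 0 2 _ _ ()
  residues 1 0 _ _ ()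
  residues 1 1 _ _ ()
  residues 1 2 _ _ ()
  residues 2 0 _ _ ()
  residues 2 1 _ _ ()
  residues 2 2 _ _ ()
  residues (suc (suc (suc (suc _)))) _ (s≤s (s≤s (s≤s (s≤s ())))) _ _
  residues _ (suc (suc (suc (suc _)))) _ (s≤s (s≤s (s≤s (s≤s ())))) _

primeFactor-3mod4-product : ∀ {ns} → All Prime ns → product ns % 4 ≡ 3 →
  ∃ λ p → Prime p × p ℕ.∣ product ns × p % 4 ≡ 3
primeFactor-3mod4-product {n ∷ ns} (n-prime ∷ ns-prime) Π%4≡3 with %4≡3-* n (product ns) Π%4≡3
... | inj₁ n%4≡3 = n , n-prime , ℕ.m∣m*n (product ns) , n%4≡3
... | inj₂ Πns%4≡3 with primeFactor-3mod4-product ns-prime Πns%4≡3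
...   | p , p-prime , p∣Πns , p%4≡3 = p , p-prime , ℕ.∣n⇒∣m*n n p∣Πns , p%4≡3

primeFactor-3mod4 : ∀ n → suc n % 4 ≡ 3 → ∃ λ p → Prime p × p ℕ.∣ suc n × p % 4 ≡ 3
primeFactor-3mod4 n N%4≡3 = fromFactorisation (factorise (suc n))
  where
  fromFactorisation : PrimeFactorisation (suc n) → ∃ λ p → Prime p × p ℕ.∣ suc n × p % 4 ≡ 3
  fromFactorisation record { factors = ns ; isFactorisation = N≡Πns ; factorsPrime = ns-prime } =
    let (p , p-prime , p∣Πns , p%4≡3) = primeFactor-3mod4-product ns-prime (subst (λ x → x % 4 ≡ 3) N≡Πns N%4≡3)
    in p , p-prime , subst (p ℕ.∣_) (sym N≡Πns) p∣Πns , p%4≡3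

4∣1+n⇒n%4≡3 : ∀ {n} → 4 ℕ.∣ suc n → n % 4 ≡ 3
4∣1+n⇒n%4≡3 (ℕ.divides (suc q) 1+n≡4+4q) = trans (cong (_% 4) (ℕₚ.suc-injective 1+n≡4+4q)) ([m+kn]%n≡m%n 3 q 4)

-4-not-fourthPower : ∀ {p} → Prime p → p % 4 ≡ 3 → ¬ IsFourthPowerMod (- + 4) p
-4-not-fourthPower {p} p-prime p%4≡3 ⁴√-4 with %4≡3⇒shape {p} p%4≡3 | ⁴√-4⇒∣z⁴+4 {p} ⁴√-4
... | r , refl | z , p∣z⁴+4 =
  Prime≡3mod4.-4-nonsquare {r} p-prime (z * z) (subst (_ ∣ₛ_) (regroup z) p∣z⁴+4)
  where
  regroup : ∀ z → z * z * z * z + + 4 ≡ z * z * (z * z) + + 4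
  regroup = solve-∀

positive : ∀ {C} → C ≡ + 5 [mod + 8 ] → (∀ p → Prime p → + p ∣ C → IsFourthPowerMod (- + 4) p) →
  ∃ λ c → C ≡ + suc c
positive {+ suc c} _ _ = c , refl
positive {+ 0} 8∣-5 _ with ℕ.∣⇒≤ 8∣-5
... | s≤s (s≤s (s≤s (s≤s (s≤s ()))))
positive {C = -[1+ n ]} C≡5[8] fourthRoots =
  let (p , p-prime , p∣N , p%4≡3) = primeFactor-3mod4 n (4∣1+n⇒n%4≡3 4∣N+1)
  in ⊥-elim (-4-not-fourthPower p-prime p%4≡3 (fourthRoots p p-prime p∣N))
  where
  4∣N+1 : 4 ℕ.∣ suc (suc n)
  4∣N+1 = ∣⇒∣ᵤ (subst (+ 4 ∣ₛ_) (negate -[1+ n ]) (∣m⇒∣-m (8∣C-5⇒4∣C-1 {C = -[1+ n ]} (∣ᵤ⇒∣ C≡5[8]))))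
    where
    negate : ∀ C → - (C - + 1) ≡ + 1 + - C
    negate = solve-∀

qpPoint-odd : ∀ {p C} → Prime p → p ≢ 2 → (+ p ∣ C → IsFourthPowerMod (- + 4) p) → HasQpPoint C p
qpPoint-odd {p} {C} p-prime p≢2 fourthRoot with oddPrime-mod4 p-prime p≢2
... | inj₁ (k , refl) = qpPoint-1mod4 {k} {C} p-prime
... | inj₂ (r , refl) = Prime≡3mod4.qpPoint-3mod4 {r} p-prime {C} fourthRoot

-- The real place

module SquareRootApproximation (c : ℕ) .{{_ : ℕ.NonZero c}} where

  search : ℕ → ℕ → ℕ
  search M zero = zero
  search M (suc a) with c ℕ.* (suc a ℕ.* suc a) ≤? M ℕ.* M
  ... | yes _ = suc a
  ... | no _ = search M a

  search-lower : ∀ M j → c ℕ.* (search M j ℕ.* search M j) ≤ M ℕ.* M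
  search-lower M zero = ℕₚ.≤-trans (ℕₚ.≤-reflexive (ℕₚ.*-zeroʳ c)) z≤n
  search-lower M (suc a) with c ℕ.* (suc a ℕ.* suc a) ≤? M ℕ.* M
  ... | yes ca²≤M² = ca²≤M²
  ... | no _ = search-lower M a

  search-upper : ∀ M j → M ℕ.* M < c ℕ.* (suc j ℕ.* suc j) →
    M ℕ.* M < c ℕ.* (suc (search M j) ℕ.* suc (search M j))
  search-upper M zero M²<c = M²<c
  search-upper M (suc a) M²<c with c ℕ.* (suc a ℕ.* suc a) ≤? M ℕ.* M
  ... | yes _ = M²<c
  ... | no ca²≰M² = search-upper M a (ℕₚ.≰⇒> ca²≰M²)

  search≤ : ∀ M j → search M j ≤ j
  search≤ M zero = z≤n
  search≤ M (suc a) with c ℕ.* (suc a ℕ.* suc a) ≤? M ℕ.* M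
  ... | yes _ = ℕₚ.≤-refl
  ... | no _ = ℕₚ.m≤n⇒m≤1+n (search≤ M a)

  -- ⌊(n + 1) / √c⌋
  approx : ℕ → ℕ
  approx n = search (suc n) (suc n)

  approx-lower : ∀ n → c ℕ.* (approx n ℕ.* approx n) ≤ suc n ℕ.* suc n
  approx-lower n = search-lower (suc n) (suc n)

  approx-upper : ∀ n → suc n ℕ.* suc n < c ℕ.* (suc (approx n) ℕ.* suc (approx n))
  approx-upper n = search-upper (suc n) (suc n) (begin-strict
    M ℕ.* M               <⟨ ℕₚ.*-mono-< (ℕₚ.n<1+n M) (ℕₚ.n<1+n M) ⟩
    suc M ℕ.* suc M       ≡⟨ ℕₚ.*-identityˡ _ ⟨
    1 ℕ.* (suc M ℕ.* suc M) ≤⟨ ℕₚ.*-monoˡ-≤ (suc M ℕ.* suc M) (ℕ.>-nonZero⁻¹ c) ⟩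
    c ℕ.* (suc M ℕ.* suc M) ∎)
    where
    open ℕₚ.≤-Reasoning
    M : ℕ
    M = suc n

  approx≤ : ∀ n → approx n ≤ suc n
  approx≤ n = search≤ (suc n) (suc n)

  approx-cross : ∀ m n → approx m ℕ.* suc n < suc (approx n) ℕ.* suc m
  approx-cross m n = square-cancel-< (ℕₚ.*-cancelˡ-< c (X ℕ.* X) (Y ℕ.* Y) (begin-strict
    c ℕ.* (X ℕ.* X)                               ≡⟨ regroup c (approx m) (suc n) ⟩
    c ℕ.* (approx m ℕ.* approx m) ℕ.* (N ℕ.* N)   ≤⟨ ℕₚ.*-monoˡ-≤ (N ℕ.* N) (approx-lower m) ⟩
    M ℕ.* M ℕ.* (N ℕ.* N)                         ≡⟨ ℕₚ.*-comm (M ℕ.* M) (N ℕ.* N) ⟩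
    N ℕ.* N ℕ.* (M ℕ.* M)                         <⟨ ℕₚ.*-monoˡ-< (M ℕ.* M) (approx-upper n) ⟩
    c ℕ.* (suc (approx n) ℕ.* suc (approx n)) ℕ.* (M ℕ.* M) ≡⟨ regroup c (suc (approx n)) (suc m) ⟨
    c ℕ.* (Y ℕ.* Y)                               ∎))
    where
    open ℕₚ.≤-Reasoning
    M : ℕ
    M = suc m
    N : ℕ
    N = suc n
    X : ℕ
    X = approx m ℕ.* N
    Y : ℕ
    Y = suc (approx n) ℕ.* M
    regroup : ∀ c a b → c ℕ.* ((a ℕ.* b) ℕ.* (a ℕ.* b)) ≡ c ℕ.* (a ℕ.* a) ℕ.* (b ℕ.* b)
    regroup = ℕ-Solver.solve-∀
    square-cancel-< : ∀ {x y} → x ℕ.* x < y ℕ.* y → x < y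
    square-cancel-< x²<y² = ℕₚ.≰⇒> (λ y≤x → ℕₚ.<⇒≱ x²<y² (ℕₚ.*-mono-≤ y≤x y≤x))

  approx-residual : ∀ n k → 3 ℕ.* c ℕ.* suc k ≤ suc n →
    (suc n ℕ.* suc n ℕ.∸ c ℕ.* (approx n ℕ.* approx n)) ℕ.* suc k ≤ suc n ℕ.* suc n
  approx-residual n k 3c[k+1]≤M = begin
    D ℕ.* suc k                       ≤⟨ ℕₚ.*-monoˡ-≤ (suc k) (ℕₚ.<⇒≤ D<c[2a+1]) ⟩
    c ℕ.* (2 ℕ.* a ℕ.+ 1) ℕ.* suc k   ≤⟨ ℕₚ.*-monoˡ-≤ (suc k) (ℕₚ.*-monoʳ-≤ c 2a+1≤3M) ⟩
    c ℕ.* (3 ℕ.* M) ℕ.* suc k         ≡⟨ regroup c M k ⟩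
    M ℕ.* (3 ℕ.* c ℕ.* suc k)         ≤⟨ ℕₚ.*-monoʳ-≤ M 3c[k+1]≤M ⟩
    M ℕ.* M                           ∎
    where
    open ℕₚ.≤-Reasoning
    M : ℕ
    M = suc n
    a : ℕ
    a = approx n
    D : ℕ
    D = M ℕ.* M ℕ.∸ c ℕ.* (a ℕ.* a)
    regroup : ∀ c M k → c ℕ.* (3 ℕ.* M) ℕ.* suc k ≡ M ℕ.* (3 ℕ.* c ℕ.* suc k)
    regroup = ℕ-Solver.solve-∀
    2a+1≤3M : 2 ℕ.* a ℕ.+ 1 ≤ 3 ℕ.* M
    2a+1≤3M = ℕₚ.≤-trans (ℕₚ.+-mono-≤ (ℕₚ.*-monoʳ-≤ 2 (approx≤ n)) (s≤s {0} {n} z≤n)) (ℕₚ.≤-reflexive (triple M))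
      where
      triple : ∀ M → 2 ℕ.* M ℕ.+ M ≡ 3 ℕ.* M
      triple = ℕ-Solver.solve-∀
    D<c[2a+1] : D < c ℕ.* (2 ℕ.* a ℕ.+ 1)
    D<c[2a+1] = ℕₚ.+-cancelʳ-< (c ℕ.* (a ℕ.* a)) D (c ℕ.* (2 ℕ.* a ℕ.+ 1))
      (subst₂ _<_ (sym (ℕₚ.m∸n+n≡m (approx-lower n))) (expand c a) (approx-upper n))
      where
      expand : ∀ c a → c ℕ.* (suc a ℕ.* suc a) ≡ c ℕ.* (2 ℕ.* a ℕ.+ 1) ℕ.+ c ℕ.* (a ℕ.* a)
      expand = ℕ-Solver.solve-∀

toℚᵘ-homo-- : ∀ x y → toℚᵘ (x ℚ.- y) ≃ᵘ toℚᵘ x ℚᵘ.- toℚᵘ y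
toℚᵘ-homo-- x y = ℚᵘₚ.≃-trans (ℚₚ.toℚᵘ-homo-+ x (ℚ.- y)) (ℚᵘₚ.+-congʳ (toℚᵘ x) (ℚₚ.toℚᵘ-homo‿- y))

∣∣≤-viaℚᵘ : ∀ {x y X Y} → toℚᵘ x ≃ᵘ X → toℚᵘ y ≃ᵘ Y → ℚᵘ.∣ X ∣ ≤ᵘ Y → ℚ.∣ x ∣ ℚ.≤ y
∣∣≤-viaℚᵘ {x} x≃X y≃Y ∣X∣≤Y = ℚₚ.toℚᵘ-cancel-≤
  (ℚᵘₚ.≤-respʳ-≃ (ℚᵘₚ.≃-sym y≃Y)
    (ℚᵘₚ.≤-respˡ-≃ (ℚᵘₚ.≃-sym (ℚᵘₚ.≃-trans (ℚₚ.toℚᵘ-homo-∣-∣ x) (ℚᵘₚ.∣-∣-cong x≃X))) ∣X∣≤Y))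

invᵘ : ℕ → ℚᵘ
invᵘ n = mkℚᵘ (+ 1) n

inv+inv≃ : ∀ m n → toℚᵘ (inv m ℚ.+ inv n) ≃ᵘ invᵘ m ℚᵘ.+ invᵘ n
inv+inv≃ m n = ℚᵘₚ.≃-trans (ℚₚ.toℚᵘ-homo-+ (inv m) (inv n))
  (ℚᵘₚ.+-cong (ℚₚ.toℚᵘ-fromℚᵘ (invᵘ m)) (ℚₚ.toℚᵘ-fromℚᵘ (invᵘ n)))

constantReal : ∀ q → IsReal (λ _ → q)
constantReal q m n =
  ∣∣≤-viaℚᵘ {q ℚ.- q} {inv m ℚ.+ inv n} {ℚᵘ.0ℚᵘ} (ℚᵘₚ.≃-trans (toℚᵘ-homo-- q q) (ℚᵘₚ.+-inverseʳ (toℚᵘ q))) (inv+inv≃ m n)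
    (*≤* (+≤+ z≤n))

∣x-y∣≤ : ∀ {x y d} → x ℕ.≤ y ℕ.+ d → y ℕ.≤ x ℕ.+ d → ℤ.∣ + x ℤ.- + y ∣ ℕ.≤ d
∣x-y∣≤ {x} {y} {d} x≤y+d y≤x+d with ℕₚ.≤-total x y
... | inj₁ x≤y = subst (ℕ._≤ d) (sym (trans ∣x-y∣≡∣x⊖y∣ (ℤₚ.∣⊖∣-≤ x≤y))) (ℕₚ.m≤n+o⇒m∸n≤o y x y≤x+d)
  where
  ∣x-y∣≡∣x⊖y∣ : ℤ.∣ + x ℤ.- + y ∣ ≡ ℤ.∣ x ℤ.⊖ y ∣
  ∣x-y∣≡∣x⊖y∣ = cong ℤ.∣_∣ (ℤₚ.m-n≡m⊖n x y)
... | inj₂ y≤x = subst (ℕ._≤ d) (sym (trans ∣x-y∣≡∣y⊖x∣ (ℤₚ.∣⊖∣-≤ y≤x))) (ℕₚ.m≤n+o⇒m∸n≤o x y x≤y+d)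
  where
  ∣x-y∣≡∣y⊖x∣ : ℤ.∣ + x ℤ.- + y ∣ ≡ ℤ.∣ y ℤ.⊖ x ∣
  ∣x-y∣≡∣y⊖x∣ = trans (cong ℤ.∣_∣ (ℤₚ.m-n≡m⊖n x y)) (ℤₚ.∣m⊖n∣≡∣n⊖m∣ x y)

module RealPoint (c : ℕ) .{{_ : ℕ.NonZero c}} where
  open SquareRootApproximation c

  -- σ n approximates 1/√c to within 1/(n + 1).
  σ : ℕ → ℚᵘ
  σ n = mkℚᵘ (+ approx n) n

  s : ℕ → ℚ
  s n = fromℚᵘ (σ n)

  σ-regular : ∀ m n → ℚᵘ.∣ σ m ℚᵘ.- σ n ∣ ≤ᵘ invᵘ m ℚᵘ.+ invᵘ n
  σ-regular m n = *≤* (ℤₚ.*-monoʳ-≤-nonNeg (+ (suc m ℕ.* suc n)) (subst₂ ℤ._≤_ ∣X∣≡ B≡ (+≤+ ∣X∣≤)))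
    where
    a : ℕ
    a = approx m ℕ.* suc n
    b : ℕ
    b = approx n ℕ.* suc m
    ∣X∣≤ : ℤ.∣ + a ℤ.- + b ∣ ℕ.≤ suc n ℕ.+ suc m
    ∣X∣≤ = ∣x-y∣≤
      (ℕₚ.≤-trans (ℕₚ.<⇒≤ (approx-cross m n)) (ℕₚ.≤-trans (ℕₚ.≤-reflexive (ℕₚ.+-comm (suc m) b))
        (ℕₚ.+-monoʳ-≤ b (ℕₚ.m≤n+m (suc m) (suc n)))))
      (ℕₚ.≤-trans (ℕₚ.<⇒≤ (approx-cross n m)) (ℕₚ.≤-trans (ℕₚ.≤-reflexive (ℕₚ.+-comm (suc n) a))
        (ℕₚ.+-monoʳ-≤ a (ℕₚ.m≤m+n (suc n) (suc m)))))
    ∣X∣≡ : + ℤ.∣ + a ℤ.- + b ∣ ≡ + ℤ.∣ + approx m ℤ.* + suc n ℤ.+ ℤ.- (+ approx n) ℤ.* + suc m ∣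
    ∣X∣≡ = cong (λ e → + ℤ.∣ e ∣) (trans (cong₂ ℤ._-_ (ℤₚ.pos-* (approx m) (suc n)) (ℤₚ.pos-* (approx n) (suc m)))
             (neg-* (+ approx m) (+ suc n) (+ approx n) (+ suc m)))
      where
      neg-* : ∀ a N b M → a ℤ.* N ℤ.- b ℤ.* M ≡ a ℤ.* N ℤ.+ ℤ.- b ℤ.* M
      neg-* = solve-∀
    B≡ : + (suc n ℕ.+ suc m) ≡ + 1 ℤ.* + suc n ℤ.+ + 1 ℤ.* + suc m
    B≡ = trans (ℤₚ.pos-+ (suc n) (suc m)) (sym (cong₂ ℤ._+_ (ℤₚ.*-identityˡ (+ suc n)) (ℤₚ.*-identityˡ (+ suc m))))

  s-real : IsReal s
  s-real m n = ∣∣≤-viaℚᵘ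
    (ℚᵘₚ.≃-trans (toℚᵘ-homo-- (s m) (s n))
      (ℚᵘₚ.+-cong (ℚₚ.toℚᵘ-fromℚᵘ (σ m)) (ℚᵘₚ.-‿cong (ℚₚ.toℚᵘ-fromℚᵘ (σ n)))))
    (inv+inv≃ m n) (σ-regular m n)

  residual : ℕ → ℚᵘ
  residual n = mkℚᵘ (+ c) 0 ℚᵘ.* (σ n ℚᵘ.* σ n) ℚᵘ.- mkℚᵘ (+ 1) 0

  residual≃ : ∀ n → toℚᵘ (curveEqℚ (+ c) 1ℚ (s n) 0ℚ) ≃ᵘ residual n
  residual≃ n = ℚᵘₚ.≃-trans (toℚᵘ-homo-- (fromℤ (+ c) ℚ.* (s n ℚ.* s n)) 1ℚ)
    (ℚᵘₚ.+-congˡ (ℚᵘ.- mkℚᵘ (+ 1) 0)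
      (ℚᵘₚ.≃-trans (ℚₚ.toℚᵘ-homo-* (fromℤ (+ c)) (s n ℚ.* s n))
        (ℚᵘₚ.*-cong (ℚₚ.toℚᵘ-fromℚᵘ (mkℚᵘ (+ c) 0))
          (ℚᵘₚ.≃-trans (ℚₚ.toℚᵘ-homo-* (s n) (s n))
            (ℚᵘₚ.*-cong (ℚₚ.toℚᵘ-fromℚᵘ (σ n)) (ℚₚ.toℚᵘ-fromℚᵘ (σ n)))))))

  ↥residual : ∀ n → ↥ residual n ≡ ℤ.- + (suc n ℕ.* suc n ℕ.∸ c ℕ.* (approx n ℕ.* approx n))
  ↥residual n = begin
    + c ℤ.* (+ a ℤ.* + a) ℤ.* + 1 ℤ.+ ℤ.- + 1 ℤ.* + (1 ℕ.* (suc n ℕ.* suc n))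
      ≡⟨ cong₂ (λ u v → u ℤ.* + 1 ℤ.+ ℤ.- + 1 ℤ.* v)
           (trans (cong (+ c ℤ.*_) (sym (ℤₚ.pos-* a a))) (sym (ℤₚ.pos-* c (a ℕ.* a)))) (cong +_ (ℕₚ.*-identityˡ _)) ⟩
    + (c ℕ.* (a ℕ.* a)) ℤ.* + 1 ℤ.+ ℤ.- + 1 ℤ.* + (suc n ℕ.* suc n)
      ≡⟨ simplify (+ (c ℕ.* (a ℕ.* a))) (+ (suc n ℕ.* suc n)) ⟩
    + (c ℕ.* (a ℕ.* a)) ℤ.- + (suc n ℕ.* suc n)
      ≡⟨ ℤₚ.m-n≡m⊖n (c ℕ.* (a ℕ.* a)) (suc n ℕ.* suc n) ⟩
    (c ℕ.* (a ℕ.* a)) ℤ.⊖ (suc n ℕ.* suc n)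
      ≡⟨ ℤₚ.⊖-≤ (approx-lower n) ⟩
    ℤ.- + (suc n ℕ.* suc n ℕ.∸ c ℕ.* (a ℕ.* a)) ∎
    where
    open ≡-Reasoning
    a : ℕ
    a = approx n
    simplify : ∀ x y → x ℤ.* + 1 ℤ.+ ℤ.- + 1 ℤ.* y ≡ x ℤ.- y
    simplify = solve-∀

  residual-small : ∀ n k → 3 ℕ.* c ℕ.* suc k ℕ.≤ suc n → ℚᵘ.∣ residual n ∣ ≤ᵘ invᵘ k
  residual-small n k 3c[k+1]≤n+1 = *≤* (subst₂ ℤ._≤_ lhs rhs (+≤+ (approx-residual n k 3c[k+1]≤n+1)))
    where
    D : ℕ
    D = suc n ℕ.* suc n ℕ.∸ c ℕ.* (approx n ℕ.* approx n)
    lhs : + (D ℕ.* suc k) ≡ + ℤ.∣ ↥ residual n ∣ ℤ.* + suc k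
    lhs = trans (ℤₚ.pos-* D (suc k))
      (cong (λ w → + w ℤ.* + suc k) (sym (trans (cong ℤ.∣_∣ (↥residual n)) (ℤₚ.∣-i∣≡∣i∣ (+ D)))))
    rhs : + (suc n ℕ.* suc n) ≡ + 1 ℤ.* ↧ residual n
    rhs = trans (cong +_ (sym (trans (ℕₚ.*-identityʳ _) (ℕₚ.*-identityˡ _)))) (sym (ℤₚ.*-identityˡ _))

  realPoint : HasRealPoint (+ c)
  realPoint = (λ _ → 1ℚ) , s , (λ _ → 0ℚ) , constantReal 1ℚ , s-real , constantReal 0ℚ , tendsToZero , inj₁ 1-apart
    where
    tendsToZero : TendsToZero (λ n → curveEqℚ (+ c) 1ℚ (s n) 0ℚ)
    tendsToZero k = 3 ℕ.* c ℕ.* suc k , λ n N≤n →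
      ∣∣≤-viaℚᵘ (residual≃ n) (ℚₚ.toℚᵘ-fromℚᵘ (invᵘ k)) (residual-small n k (ℕₚ.m≤n⇒m≤1+n N≤n))
    1-apart : ApartZero (λ _ → 1ℚ)
    1-apart = 1 , ℚ.*<* (+<+ (s≤s (s≤s z≤n)))

proposition4p5 : (C : ℤ) → SquareFree C → C ≡ + 5 [mod + 8 ]
    → (∀ (p : ℕ) → Prime p → + p ∣ C → IsFourthPowerMod (- + 4) p)
    → EverywhereLocallySoluble C
proposition4p5 C _ C≡5[8] fourthRoots = realPoint , qpPoint
  where
  realPoint : HasRealPoint C
  realPoint with positive {C} C≡5[8] fourthRoots
  ... | c , refl = RealPoint.realPoint (suc c)
  qpPoint : ∀ p → Prime p → HasQpPoint C p
  qpPoint p p-prime with p ℕₚ.≟ 2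
  ... | yes refl = qpPoint₂ {C} (∣ᵤ⇒∣ C≡5[8])
  ... | no p≢2 = qpPoint-odd {p} {C} p-prime p≢2 (fourthRoots p p-prime)
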